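{- Let $r\le d$ be positive integers. Then for every positive integer $s$, $$N_{d,r}(s)=\begin{cases} N_{d,1}(s), & 1\le s\le d,\\ N_{d,1}(s)+(r-1)\,N_{d,1}(s-2d), & s\ge d+1.\end{cases}$$
   Context: A partition $\lambda=(\lambda_1,\dots,\lambda_k)$ is a finite nonincreasing sequence of positive integers (the empty partition is allowed). In its Young diagram (row $i$ has $\lambda_i$ left-justified cells), the hook length $h(i,j)$ of cell $(i,j)$ is $1$ plus the number of cells to its right in its row plus the number of cells below it in its column. For a positive integer $t$, $\lambda$ is $t$-core if no cell has hook length $t$; it is $(s,s+r)$-core if it is both $s$-core and $(s+r)$-core. $\lambda$ has $d$-distinct parts if $\lambda_i-\lambda_{i+1}\ge d$ for all $1\le i\le k-1$. For positive integers $d,r,s$, $N_{d,r}(s)$ is the number of $(s,s+r)$-core partitions with $d$-distinct parts. A set $S\subseteq\mathbb{Z}$ is $d$-th order twin-free if $|x-y|>d$ for all distinct $x,y\in S$. For positive integers $r\le d$ and integers $s\le 0$, $N_{d,r}(s)$ is defined as the number of subsets $\beta\subseteq\{1,2,\dots,s+r-1\}$ (this set is empty if $s+r-1\le 0$) such that (1) $x-s\in\beta$ for all $x\in\beta$ with $x\ge s$; (2) $x-(s+r)\in\beta$ for all $x\in\beta$ with $x\ge s+r$; (3) $\beta$ is $d$-th order twin-free. (In particular, this is used for $N_{d,1}(s-2d)$ when $s-2d\le 0$.) -}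

module Defs where

open import Data.Nat as ℕ using (ℕ; zero; suc; _+_; _∸_; _<_; _≤_; _<?_)
open import Data.Integer as ℤ using (ℤ; +_; -[1+_])
open import Data.List using (List; length; lookup; filter)
open import Data.List.Relation.Unary.All using (All)
open import Data.List.Relation.Unary.Linked using (Linked)
open import Data.List.Relation.Unary.Unique.Propositional using (Unique)
open import Data.List.Membership.Propositional using (_∈_)
open import Data.Fin using (Fin; toℕ)
open import Data.Product using (Σ; _×_)
open import Function.Bundles using (_⇔_)
open import Relation.Binary.PropositionalEquality using (_≡_; _≢_)

IsPartition : List ℕ → Set
IsPartition λs = All (0 <_) λs × Linked ℕ._≥_ λs

colLen : List ℕ → ℕ → ℕ
colLen λs j = length (filter (j <?_) λs)

-- hook length of cell (i , j) (0-indexed, j < λ_i):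
-- 1 + arm + leg = (λ_i - j) + (λ'_j - i) - 1
hook : (λs : List ℕ) → Fin (length λs) → ℕ → ℕ
hook λs i j = ((lookup λs i ∸ j) + (colLen λs j ∸ toℕ i)) ∸ 1

IsCore : ℕ → List ℕ → Set
IsCore t λs = (i : Fin (length λs)) (j : ℕ) → j < lookup λs i → hook λs i j ≢ t

DDistinct : ℕ → List ℕ → Set
DDistinct d λs = Linked (λ a b → b + d ≤ a) λs

-- "P holds for exactly n objects": an explicit duplicate-free enumeration
-- of length n of the objects satisfying P.
HasCount : {A : Set} → (A → Set) → ℕ → Set
HasCount {A} P n =
  Σ (List A) (λ xs → (length xs ≡ n) × Unique xs × ((x : A) → P x ⇔ (x ∈ xs)))

CoreDD : ℕ → ℕ → ℕ → List ℕ → Set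
CoreDD d r s λs = IsPartition λs × IsCore s λs × IsCore (s + r) λs × DDistinct d λs

-- For integer s ≤ 0: subsets β ⊆ {1, …, s+r-1}, represented as strictly
-- increasing lists of integers, satisfying conditions (1)-(3).
BetaSet : ℕ → ℕ → ℤ → List ℤ → Set
BetaSet d r s β =
  Linked ℤ._<_ β
  × All (λ x → (+ 1 ℤ.≤ x) × (x ℤ.≤ (s ℤ.+ + r) ℤ.- + 1)) β
  × All (λ x → s ℤ.≤ x → (x ℤ.- s) ∈ β) β
  × All (λ x → (s ℤ.+ + r) ℤ.≤ x → (x ℤ.- (s ℤ.+ + r)) ∈ β) β
  × ((x y : ℤ) → x ∈ β → y ∈ β → x ≢ y → d < ℤ.∣ x ℤ.- y ∣)

N : ℕ → ℕ → ℤ → ℕ → Set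
N d r (+ suc k)  n = HasCount (CoreDD d r (suc k)) n
N d r (+ zero)   n = HasCount (BetaSet d r (+ zero)) n
N d r -[1+ k ]   n = HasCount (BetaSet d r -[1+ k ]) n

module Submission where

-- A partition λ = (λ₁, …, λₖ) is recorded by its first-column hook lengths β = {λᵢ + k − i}.
-- This turns d-distinct parts into a positive d-th order twin-free set, and being a t-core
-- into closedness of β under b ↦ b − t (for b ≥ t). A twin-free β ⊆ {1, …, s − 1} is trivially
-- (s, s + r)-closed. Otherwise the top element of β is c + s with c ∈ β; twin-freeness and
-- closedness under s + r force 1 ≤ c < r ≤ d < s, so c is the least element of β and the
-- remaining elements form a copy of a twin-free δ ⊆ {1, …, s − 2d − 1} shifted by c + d.
-- Writing T(n) for the number of twin-free subsets of {1, …, n}, this gives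
-- N_{d,r}(s) = T(s − 1) + [s > d] (r − 1) T(s − 2d − 1), and the case r = 1 identifies T
-- with N_{d,1} (with T(n) = 1 for n ≤ 0, matching N_{d,1} at nonpositive arguments).

open import Defs
open import Data.Nat using (ℕ; zero; suc; _+_; _*_; _∸_; _≤_; _<_; _>_; _≥_; _<?_; _≤?_; _≟_; z≤n; s≤s)
open import Data.Nat.Properties
open import Data.Nat.Tactic.RingSolver using (solve-∀)
open import Algebra.Properties.CommutativeSemigroup +-commutativeSemigroup using (xy∙z≈xz∙y)
open import Data.Integer using (+_; _-_)
open import Data.Integer as ℤ using (ℤ; -[1+_])
import Data.Integer.Properties as ℤ
open import Data.List using (List; []; _∷_; [_]; _++_; length; lookup; filter; map; applyUpTo; cartesianProductWith)
open import Data.List.Properties using (length-applyUpTo; length-map; length-++; filter-accept; filter-reject; length-filter; map-∘; map-id-local; map-injective; ++-cancelʳ; ∷-injectiveˡ; ∷-injectiveʳ)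
open import Data.List.Relation.Unary.All as All using (All; []; _∷_)
import Data.List.Relation.Unary.All.Properties as All
open import Data.List.Relation.Unary.AllPairs as AllPairs using (AllPairs; []; _∷_)
open import Data.List.Relation.Unary.Linked as Linked using (Linked; []; [-]; _∷_)
import Data.List.Relation.Unary.Linked.Properties as Linked
import Data.List.Relation.Unary.AllPairs.Properties as AllPairs
open import Data.List.Relation.Unary.Unique.Propositional using (Unique)
import Data.List.Relation.Unary.Unique.Propositional.Properties as Unique
open import Data.List.Relation.Unary.Any using (here; there)
open import Data.List.Membership.Propositional using (_∈_; _∉_)
open import Data.List.Membership.Propositional.Properties using (∈-map⁺; ∈-map⁻; ∈-++⁺ˡ; ∈-++⁺ʳ; ∈-++⁻; ∈-filter⁺; ∈-filter⁻; ∈-lookup; ∈-applyUpTo⁺; ∈-applyUpTo⁻; ∈-cartesianProductWith⁺; ∈-cartesianProductWith⁻)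
open import Data.List.Membership.DecPropositional _≟_ using (_∈?_)
open import Data.Fin using () renaming (zero to fzero; suc to fsuc)
open import Data.Product using (∃-syntax; _×_; _,_; proj₁; proj₂)
open import Data.Sum using (_⊎_; inj₁; inj₂)
open import Data.Unit using (⊤; tt)
open import Data.Empty using (⊥-elim)
open import Function using (_∘_)
open import Function.Bundles using (_⇔_; mk⇔; Equivalence)
open import Level using (0ℓ)
open import Relation.Binary using (Rel; Transitive)
open import Relation.Nullary using (¬_; yes; no)
open import Relation.Binary.PropositionalEquality using (_≡_; _≢_; refl; sym; trans; cong; cong₂; subst; subst₂; module ≡-Reasoning)

HasCount-transport : {A B : Set} {P : A → Set} {Q : B → Set} {n : ℕ} (f : A → B) (g : B → A) →
  (∀ {a} → P a → Q (f a)) → (∀ {b} → Q b → P (g b)) → (∀ {a} → P a → g (f a) ≡ a) →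
  (∀ {b} → Q b → f (g b) ≡ b) → HasCount P n → HasCount Q n
HasCount-transport {P = P} {Q} f g P⇒Q Q⇒P gf fg (xs , len , unique , P⇔∈) =
  map f xs , trans (length-map f xs) len , unique-image , λ b → mk⇔ (to b) (from b)
  where
  P-xs : All P xs
  P-xs = All.tabulate (λ {a} → Equivalence.from (P⇔∈ a))
  unique-image : Unique (map f xs)
  unique-image = Unique.map⁻ {f = g}
    (subst Unique (sym (trans (sym (map-∘ xs)) (map-id-local (All.map gf P-xs)))) unique)
  to : ∀ b → Q b → b ∈ map f xs
  to b q = subst (_∈ map f xs) (fg q) (∈-map⁺ f (Equivalence.to (P⇔∈ (g b)) (Q⇒P q)))
  from : ∀ b → b ∈ map f xs → Q b
  from b b∈ with ∈-map⁻ f b∈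
  ... | a , a∈ , refl = P⇒Q (Equivalence.from (P⇔∈ a) a∈)

Linked⇒All-head : ∀ {A : Set} {R : Rel A 0ℓ} → Transitive R → ∀ {x xs} → Linked R (x ∷ xs) → All (R x) xs
Linked⇒All-head R-trans = AllPairs.head ∘ Linked.Linked⇒AllPairs R-trans

Linked-++⁻ˡ : ∀ {A : Set} {R : Rel A 0ℓ} xs {ys} → Linked R (xs ++ ys) → Linked R xs
Linked-++⁻ˡ [] _ = []
Linked-++⁻ˡ (x ∷ []) _ = [-]
Linked-++⁻ˡ (x ∷ y ∷ xs) (Rxy ∷ rest) = Rxy ∷ Linked-++⁻ˡ (y ∷ xs) rest

length-cartesianProductWith : ∀ {A B C : Set} (f : A → B → C) xs ys →
                              length (cartesianProductWith f xs ys) ≡ length xs * length ys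
length-cartesianProductWith f [] ys = refl
length-cartesianProductWith f (x ∷ xs) ys =
  trans (length-++ (map (f x) ys)) (cong₂ _+_ (length-map (f x) ys) (length-cartesianProductWith f xs ys))

m+n≡o+p⇒m≡p⇔n≡o : ∀ {m n o p} → m + n ≡ o + p → m ≡ p ⇔ n ≡ o
m+n≡o+p⇒m≡p⇔n≡o {m} {n} {o} {p} eq = mk⇔
  (λ { refl → +-cancelʳ-≡ m n o (trans (+-comm n m) eq) })
  (λ { refl → +-cancelʳ-≡ n m p (trans eq (+-comm n p)) })

positive-∸⇒< : ∀ {m n} → 0 < n ∸ m → m < n
positive-∸⇒< {m} {n} 0<n∸m = ∸-cancelʳ-< (subst (_< n ∸ m) (sym (n∸n≡0 n)) 0<n∸m)

≤∸⇒+≤ : ∀ {e m n} → 0 < e → e ≤ n ∸ m → e + m ≤ n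
≤∸⇒+≤ {e} 0<e e≤n∸m = m≤o∸n⇒m+n≤o e (<⇒≤ (positive-∸⇒< (<-≤-trans 0<e e≤n∸m))) e≤n∸m

≤∸1⇔< : ∀ {c} r → 1 ≤ c → c ≤ r ∸ 1 ⇔ c < r
≤∸1⇔< {c} r 1≤c = mk⇔ (λ c≤r∸1 → subst (_≤ r) (+-comm c 1) (≤∸⇒+≤ 1≤c c≤r∸1))
                        (λ c<r → m+n≤o⇒m≤o∸n c (subst (_≤ r) (+-comm 1 c) c<r))

-- Partitions and β-sets

betaSet : List ℕ → List ℕ
betaSet [] = []
betaSet (x ∷ xs) = x + length xs ∷ betaSet xs

fromBetaSet : List ℕ → List ℕ
fromBetaSet [] = []
fromBetaSet (b ∷ bs) = b ∸ length bs ∷ fromBetaSet bs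

length-betaSet : ∀ xs → length (betaSet xs) ≡ length xs
length-betaSet [] = refl
length-betaSet (x ∷ xs) = cong suc (length-betaSet xs)

length-fromBetaSet : ∀ bs → length (fromBetaSet bs) ≡ length bs
length-fromBetaSet [] = refl
length-fromBetaSet (b ∷ bs) = cong suc (length-fromBetaSet bs)

fromBetaSet-betaSet : ∀ xs → fromBetaSet (betaSet xs) ≡ xs
fromBetaSet-betaSet [] = refl
fromBetaSet-betaSet (x ∷ xs)
  rewrite length-betaSet xs | m+n∸n≡m x (length xs) | fromBetaSet-betaSet xs = refl

Positive : List ℕ → Set
Positive = All (0 <_)

Decreasing : List ℕ → Set
Decreasing = Linked _>_

Nonincreasing : List ℕ → Set
Nonincreasing = Linked _≥_

Decreasing⇒All<head : ∀ {x xs} → Decreasing (x ∷ xs) → All (_< x) xs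
Decreasing⇒All<head = Linked⇒All-head (λ x>y y>z → <-trans y>z x>y)

length<head : ∀ {b bs} → Decreasing (b ∷ bs) → Positive (b ∷ bs) → length bs < b
length<head {bs = []} _ (0<b ∷ _) = 0<b
length<head {bs = _ ∷ _} (b>b′ ∷ dec) (_ ∷ pos) = <-≤-trans (s≤s (length<head dec pos)) b>b′

betaSet-fromBetaSet : ∀ {bs} → Decreasing bs → Positive bs → betaSet (fromBetaSet bs) ≡ bs
betaSet-fromBetaSet {[]} _ _ = refl
betaSet-fromBetaSet {b ∷ bs} dec pos
  rewrite length-fromBetaSet bs | m∸n+n≡m (<⇒≤ (length<head dec pos))
        | betaSet-fromBetaSet (Linked.tail dec) (All.tail pos) = refl

betaSet-positive : ∀ {xs} → Positive xs → Positive (betaSet xs)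
betaSet-positive {[]} [] = []
betaSet-positive {x ∷ xs} (0<x ∷ pos) = ≤-trans 0<x (m≤m+n x (length xs)) ∷ betaSet-positive pos

fromBetaSet-positive : ∀ {bs} → Decreasing bs → Positive bs → Positive (fromBetaSet bs)
fromBetaSet-positive {[]} _ _ = []
fromBetaSet-positive {b ∷ bs} dec pos =
  m<n⇒0<n∸m (length<head dec pos) ∷ fromBetaSet-positive (Linked.tail dec) (All.tail pos)

-- Twin-free sets are stored as decreasing lists, for which gaps > d between neighbours suffice.
Apart : ℕ → ℕ → ℕ → Set
Apart d a b = b + d < a

TwinFree : ℕ → List ℕ → Set
TwinFree d = Linked (Apart d)

Apart-trans : ∀ {d} → Transitive (Apart d)
Apart-trans {d} {a} {b} {c} b+d<a c+d<b = <-trans c+d<b (≤-<-trans (m≤m+n b d) b+d<a)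

TwinFree⇒Decreasing : ∀ {d bs} → TwinFree d bs → Decreasing bs
TwinFree⇒Decreasing {d} = Linked.map (λ {_} {b} b+d<a → ≤-<-trans (m≤m+n b d) b+d<a)

Apart-+ : ∀ {d a b} k → Apart d a b → Apart d (a + k) (b + k)
Apart-+ {d} {a} {b} k b+d<a = subst (_< a + k) (sym (xy∙z≈xz∙y b k d)) (+-monoˡ-< k b+d<a)

Apart-∸ : ∀ {d a b} k → k ≤ b → Apart d a b → Apart d (a ∸ k) (b ∸ k)
Apart-∸ {d} {a} {b} k k≤b b+d<a = m+n≤o⇒m≤o∸n (suc (b ∸ k + d)) (subst (_< a) (sym regroup) b+d<a)
  where
  regroup : b ∸ k + d + k ≡ b + d
  regroup = trans (xy∙z≈xz∙y (b ∸ k) d k) (cong (_+ d) (m∸n+n≡m k≤b))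

twinFree-∸ : ∀ {d} k {γ} → All (k ≤_) γ → TwinFree d γ → TwinFree d (map (_∸ k) γ)
twinFree-∸ k _ [] = []
twinFree-∸ k _ [-] = [-]
twinFree-∸ k (_ ∷ k≤b ∷ k≤) (b+d<a ∷ tf) = Apart-∸ k k≤b b+d<a ∷ twinFree-∸ k (k≤b ∷ k≤) tf

twinFree-trichotomy : ∀ {d x y xs} → TwinFree d xs → x ∈ xs → y ∈ xs → x ≡ y ⊎ Apart d x y ⊎ Apart d y x
twinFree-trichotomy tf (here refl) (here refl) = inj₁ refl
twinFree-trichotomy tf (here refl) (there y∈) = inj₂ (inj₁ (All.lookup (Linked⇒All-head Apart-trans tf) y∈))
twinFree-trichotomy tf (there x∈) (here refl) = inj₂ (inj₂ (All.lookup (Linked⇒All-head Apart-trans tf) x∈))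
twinFree-trichotomy tf (there x∈) (there y∈) = twinFree-trichotomy (Linked.tail tf) x∈ y∈

twinFree-no-close-pair : ∀ {d r x y xs} → TwinFree d xs → x ∈ xs → y ∈ xs → 1 ≤ r → r ≤ d → x ≢ y + r
twinFree-no-close-pair {d} {r} {y = y} tf x∈ y∈ 1≤r r≤d refl with twinFree-trichotomy tf x∈ y∈
... | inj₁ y+r≡y = <-irrefl (sym y+r≡y) (m<m+n y 1≤r)
... | inj₂ (inj₁ y+d<y+r) = <⇒≱ (+-cancelˡ-< y d r y+d<y+r) r≤d
... | inj₂ (inj₂ y+r+d<y) = <⇒≱ y+r+d<y (≤-trans (m≤m+n y r) (m≤m+n _ d))

DDistinct⇒Nonincreasing : ∀ {d xs} → DDistinct d xs → Nonincreasing xs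
DDistinct⇒Nonincreasing {d} = Linked.map (λ {_} {b} b+d≤a → ≤-trans (m≤m+n b d) b+d≤a)

betaSet-twinFree : ∀ {d xs} → DDistinct d xs → TwinFree d (betaSet xs)
betaSet-twinFree [] = []
betaSet-twinFree [-] = [-]
betaSet-twinFree {d} {x ∷ y ∷ ys} (y+d≤x ∷ dd) = apart ∷ betaSet-twinFree dd
  where
  k : ℕ
  k = length ys
  apart : (y + k) + d < x + suc k
  apart = begin-strict
    (y + k) + d   ≡⟨ xy∙z≈xz∙y y k d ⟩
    (y + d) + k   ≤⟨ +-monoˡ-≤ k y+d≤x ⟩
    x + k         <⟨ +-monoʳ-< x (n<1+n k) ⟩
    x + suc k     ∎
    where open ≤-Reasoning

fromBetaSet-dDistinct : ∀ {d bs} → TwinFree d bs → Positive bs → DDistinct d (fromBetaSet bs)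
fromBetaSet-dDistinct [] _ = []
fromBetaSet-dDistinct [-] _ = [-]
fromBetaSet-dDistinct {d} {b ∷ b′ ∷ bs} (b′+d<b ∷ tf) (_ ∷ pos) =
  m+n≤o⇒m≤o∸n ((b′ ∸ k) + d) bound ∷ fromBetaSet-dDistinct tf pos
  where
  k : ℕ
  k = length bs
  k<b′ : k < b′
  k<b′ = length<head (TwinFree⇒Decreasing tf) pos
  bound : (b′ ∸ k) + d + suc k ≤ b
  bound = begin
    (b′ ∸ k) + d + suc k   ≡⟨ +-suc _ k ⟩
    suc ((b′ ∸ k) + d + k) ≡⟨ cong suc (xy∙z≈xz∙y (b′ ∸ k) d k) ⟩
    suc ((b′ ∸ k) + k + d) ≡⟨ cong (λ z → suc (z + d)) (m∸n+n≡m (<⇒≤ k<b′)) ⟩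
    suc (b′ + d)           ≤⟨ b′+d<b ⟩
    b                      ∎
    where open ≤-Reasoning

-- Hook lengths in terms of β-sets

parts≤head : ∀ {x xs} → Nonincreasing (x ∷ xs) → All (_≤ x) xs
parts≤head = Linked⇒All-head (λ x≥y y≥z → ≤-trans y≥z x≥y)

colLen-∷-< : ∀ {x xs j} → j < x → colLen (x ∷ xs) j ≡ suc (colLen xs j)
colLen-∷-< {x} {xs} {j} j<x = cong length (filter-accept (j <?_) {x} {xs} j<x)

colLen≡0 : ∀ {xs j} → All (_≤ j) xs → colLen xs j ≡ 0
colLen≡0 [] = refl
colLen≡0 {x ∷ xs} {j} (x≤j ∷ xs≤j) =
  trans (cong length (filter-reject (j <?_) {x} {xs} (≤⇒≯ x≤j))) (colLen≡0 xs≤j)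

colLen-beyond-head : ∀ {x xs j} → Nonincreasing (x ∷ xs) → x ≤ j → colLen (x ∷ xs) j ≡ 0
colLen-beyond-head ni x≤j = colLen≡0 (x≤j ∷ All.map (λ y≤x → ≤-trans y≤x x≤j) (parts≤head ni))

colLen≤length : ∀ xs j → colLen xs j ≤ length xs
colLen≤length xs j = length-filter (j <?_) xs

hook-head-row : ∀ {x xs j} → j < x → hook (x ∷ xs) fzero j ≡ (x ∸ j) + colLen xs j
hook-head-row {x} {xs} {j} j<x rewrite colLen-∷-< {x} {xs} j<x | +-suc (x ∸ j) (colLen xs j) = refl

hook-lower-row : ∀ {x xs} i {j} → j < lookup xs i → lookup xs i ≤ x → hook (x ∷ xs) (fsuc i) j ≡ hook xs i j
hook-lower-row {x} {xs} i j<xᵢ xᵢ≤x rewrite colLen-∷-< {x} {xs} (<-≤-trans j<xᵢ xᵢ≤x) = refl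

betaSet-below : ∀ {y ys} → Nonincreasing (y ∷ ys) → All (_< y + length ys) (betaSet ys)
betaSet-below {y} {[]} _ = []
betaSet-below {y} {z ∷ zs} ni@(z≤y ∷ _) =
  <-≤-trans (+-monoˡ-< (length zs) (s≤s z≤y)) (≤-reflexive (sym (+-suc y (length zs))))
  ∷ All.map (λ b<z+k → <-≤-trans b<z+k (+-mono-≤ z≤y (n≤1+n _))) (betaSet-below (Linked.tail ni))

∉-betaSet-above : ∀ {y ys m} → Nonincreasing (y ∷ ys) → y + length ys < m → m ∉ betaSet (y ∷ ys)
∉-betaSet-above _ top<m (here refl) = <-irrefl refl top<m
∉-betaSet-above ni top<m (there m∈) = <-asym top<m (All.lookup (betaSet-below ni) m∈)

m+colLen-∷ : ∀ {y ys j} m → j < y → m + colLen (y ∷ ys) j ≡ suc (m + colLen ys j)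
m+colLen-∷ m j<y = trans (cong (_+_ m) (colLen-∷-< j<y)) (+-suc m _)

-- With k = length xs, column j < x of the row x corresponds to the gap m = j + k − colLen xs j
-- of betaSet xs below x + k, and its hook length is x + k − m.
column⇒gap : ∀ {x xs j m} → Nonincreasing (x ∷ xs) → j < x → j + length xs ≡ m + colLen xs j →
             m < x + length xs × m ∉ betaSet xs
column⇒gap {x} {[]} {j} {m} _ j<x eq = subst (_< x + 0) (+-cancelʳ-≡ 0 j m eq) (<-≤-trans j<x (m≤m+n x 0)) , λ ()
column⇒gap {x} {y ∷ ys} {j} {m} (y≤x ∷ ni) j<x eq with j <? y
... | yes j<y = <-≤-trans m<y+k (+-mono-≤ y≤x (n≤1+n k)) , m∉
  where
  k : ℕ
  k = length ys
  ih : m < y + k × m ∉ betaSet ys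
  ih = column⇒gap ni j<y (suc-injective (trans (sym (+-suc j k)) (trans eq (m+colLen-∷ m j<y))))
  m<y+k : m < y + k
  m<y+k = proj₁ ih
  m∉ : m ∉ betaSet (y ∷ ys)
  m∉ (here refl) = <-irrefl refl m<y+k
  m∉ (there m∈) = proj₂ ih m∈
... | no j≮y = subst (_< x + suc k) (sym m≡) (+-monoˡ-< (suc k) j<x) , ∉-betaSet-above ni y+k<m
  where
  k : ℕ
  k = length ys
  m≡ : m ≡ j + suc k
  m≡ = sym (trans eq (trans (cong (_+_ m) (colLen-beyond-head ni (≮⇒≥ j≮y))) (+-identityʳ m)))
  y+k<m : y + k < m
  y+k<m = subst (y + k <_) (sym m≡) (<-≤-trans (+-monoʳ-< y (n<1+n k)) (+-monoˡ-≤ (suc k) (≮⇒≥ j≮y)))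

gap⇒column : ∀ {x xs m} → Nonincreasing (x ∷ xs) → m < x + length xs → m ∉ betaSet xs →
             ∃[ j ] j < x × j + length xs ≡ m + colLen xs j
gap⇒column {x} {[]} {m} _ m<x _ = m , subst (m <_) (+-identityʳ x) m<x , refl
gap⇒column {x} {y ∷ ys} {m} (y≤x ∷ ni) m<x+k m∉ with m <? y + length ys
... | yes m<y+k =
  let j , j<y , eq = gap⇒column ni m<y+k (m∉ ∘ there)
  in j , <-≤-trans j<y y≤x , trans (+-suc j _) (trans (cong suc eq) (sym (m+colLen-∷ m j<y)))
... | no m≮y+k = m ∸ suc k , j<x , eq
  where
  k : ℕ
  k = length ys
  y+k<m : y + k < m
  y+k<m = ≤∧≢⇒< (≮⇒≥ m≮y+k) (λ y+k≡m → m∉ (here (sym y+k≡m)))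
  y+sk≤m : y + suc k ≤ m
  y+sk≤m = subst (_≤ m) (sym (+-suc y k)) y+k<m
  sk≤m : suc k ≤ m
  sk≤m = m+n≤o⇒n≤o y y+sk≤m
  j<x : m ∸ suc k < x
  j<x = +-cancelʳ-< (suc k) _ x (subst (_< x + suc k) (sym (m∸n+n≡m sk≤m)) m<x+k)
  eq : m ∸ suc k + suc k ≡ m + colLen (y ∷ ys) (m ∸ suc k)
  eq = trans (m∸n+n≡m sk≤m)
             (sym (trans (cong (_+_ m) (colLen-beyond-head ni (m+n≤o⇒m≤o∸n y y+sk≤m))) (+-identityʳ m)))

ClosedUnder : ℕ → List ℕ → Set
ClosedUnder t [] = ⊤
ClosedUnder t (b ∷ bs) = (t ≤ b → b ∸ t ∈ bs) × ClosedUnder t bs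

closedUnder-below : ∀ {t β} → All (_< t) β → ClosedUnder t β
closedUnder-below [] = tt
closedUnder-below (b<t ∷ bs<t) = (λ t≤b → ⊥-elim (<⇒≱ b<t t≤b)) , closedUnder-below bs<t

HeadRowAvoids : ℕ → ℕ → List ℕ → Set
HeadRowAvoids t x xs = ∀ j → j < x → (x ∸ j) + colLen xs j ≢ t

-- Both sides equal x + k + c, which links the hook (x ∸ j) + c to the gap x + k ∸ t.
hook≡⇔column : ∀ {x k t j c} → j ≤ x → t ≤ x + k → (x ∸ j) + c ≡ t ⇔ j + k ≡ (x + k ∸ t) + c
hook≡⇔column {x} {k} {t} {j} {c} j≤x t≤x+k = m+n≡o+p⇒m≡p⇔n≡o (begin
  ((x ∸ j) + c) + (j + k)   ≡⟨ regroup₁ (x ∸ j) c j k ⟩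
  ((x ∸ j) + j + k) + c     ≡⟨ cong (λ z → z + k + c) (m∸n+n≡m j≤x) ⟩
  (x + k) + c               ≡⟨ cong (_+ c) (sym (m∸n+n≡m t≤x+k)) ⟩
  (x + k ∸ t) + t + c       ≡⟨ regroup₂ (x + k ∸ t) t c ⟩
  (x + k ∸ t + c) + t       ∎)
  where
  open ≡-Reasoning
  regroup₁ : ∀ a c j k → (a + c) + (j + k) ≡ (a + j + k) + c
  regroup₁ = solve-∀
  regroup₂ : ∀ u t c → u + t + c ≡ (u + c) + t
  regroup₂ = solve-∀

headRowAvoids⇒closed : ∀ {t x xs} → 1 ≤ t → Nonincreasing (x ∷ xs) → HeadRowAvoids t x xs →
                       t ≤ x + length xs → x + length xs ∸ t ∈ betaSet xs
headRowAvoids⇒closed {t} {x} {xs} 1≤t ni avoids t≤x+k with x + length xs ∸ t ∈? betaSet xs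
... | yes gap∈ = gap∈
... | no gap∉ =
  let j , j<x , eq = gap⇒column ni (∸-monoʳ-< {x + length xs} {t} {0} 1≤t t≤x+k) gap∉
  in ⊥-elim (avoids j j<x (Equivalence.from (hook≡⇔column (<⇒≤ j<x) t≤x+k) eq))

closed⇒headRowAvoids : ∀ {t x xs} → Nonincreasing (x ∷ xs) →
                       (t ≤ x + length xs → x + length xs ∸ t ∈ betaSet xs) → HeadRowAvoids t x xs
closed⇒headRowAvoids {t} {x} {xs} ni closed j j<x hook≡t =
  proj₂ (column⇒gap ni j<x (Equivalence.to (hook≡⇔column (<⇒≤ j<x) t≤x+k) hook≡t)) (closed t≤x+k)
  where
  t≤x+k : t ≤ x + length xs
  t≤x+k = subst (_≤ x + length xs) hook≡t (+-mono-≤ (m∸n≤m x j) (colLen≤length xs j))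

isCore-∷⁻ : ∀ {t x xs} → Nonincreasing (x ∷ xs) → IsCore t (x ∷ xs) → HeadRowAvoids t x xs × IsCore t xs
isCore-∷⁻ {xs = xs} ni core =
  (λ j j<x hook≡t → core fzero j j<x (trans (hook-head-row j<x) hook≡t)) ,
  (λ i j j<xᵢ hook≡t → core (fsuc i) j j<xᵢ
    (trans (hook-lower-row i j<xᵢ (All.lookup (parts≤head ni) (∈-lookup {xs = xs} i))) hook≡t))

isCore-∷⁺ : ∀ {t x xs} → Nonincreasing (x ∷ xs) → HeadRowAvoids t x xs → IsCore t xs → IsCore t (x ∷ xs)
isCore-∷⁺ ni avoids core fzero j j<x hook≡t = avoids j j<x (trans (sym (hook-head-row j<x)) hook≡t)
isCore-∷⁺ {xs = xs} ni avoids core (fsuc i) j j<xᵢ hook≡t =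
  core i j j<xᵢ (trans (sym (hook-lower-row i j<xᵢ (All.lookup (parts≤head ni) (∈-lookup {xs = xs} i)))) hook≡t)

isCore⇒closed : ∀ {t xs} → 1 ≤ t → Nonincreasing xs → IsCore t xs → ClosedUnder t (betaSet xs)
isCore⇒closed {xs = []} _ _ _ = tt
isCore⇒closed {xs = x ∷ xs} 1≤t ni core =
  let avoids , core′ = isCore-∷⁻ ni core
  in headRowAvoids⇒closed 1≤t ni avoids , isCore⇒closed 1≤t (Linked.tail ni) core′

closed⇒isCore : ∀ {t xs} → Nonincreasing xs → ClosedUnder t (betaSet xs) → IsCore t xs
closed⇒isCore {xs = []} _ _ ()
closed⇒isCore {xs = x ∷ xs} ni (closed , closed′) =
  isCore-∷⁺ ni (closed⇒headRowAvoids ni closed) (closed⇒isCore (Linked.tail ni) closed′)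

CoreBeta : ℕ → ℕ → ℕ → List ℕ → Set
CoreBeta d r s β = TwinFree d β × Positive β × ClosedUnder s β × ClosedUnder (s + r) β

coreDD⇒coreBeta : ∀ {d r s xs} → 1 ≤ s → CoreDD d r s xs → CoreBeta d r s (betaSet xs)
coreDD⇒coreBeta {s = s} 1≤s ((pos , ni) , s-core , s+r-core , dd) =
  betaSet-twinFree dd , betaSet-positive pos ,
  isCore⇒closed 1≤s ni s-core , isCore⇒closed (≤-trans 1≤s (m≤m+n s _)) ni s+r-core

coreBeta⇒coreDD : ∀ {d r s β} → CoreBeta d r s β → CoreDD d r s (fromBetaSet β)
coreBeta⇒coreDD {d} {r} {s} {β} (tf , pos , s-closed , s+r-closed) =
  (fromBetaSet-positive dec pos , ni) ,
  closed⇒isCore ni (subst (ClosedUnder s) (sym β≡) s-closed) ,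
  closed⇒isCore ni (subst (ClosedUnder (s + r)) (sym β≡) s+r-closed) ,
  dd
  where
  dec : Decreasing β
  dec = TwinFree⇒Decreasing tf
  dd : DDistinct d (fromBetaSet β)
  dd = fromBetaSet-dDistinct tf pos
  ni : Nonincreasing (fromBetaSet β)
  ni = DDistinct⇒Nonincreasing dd
  β≡ : betaSet (fromBetaSet β) ≡ β
  β≡ = betaSet-fromBetaSet dec pos

hasCount-coreDD : ∀ {d r s n} → 1 ≤ s → HasCount (CoreBeta d r s) n → HasCount (CoreDD d r s) n
hasCount-coreDD 1≤s = HasCount-transport fromBetaSet betaSet coreBeta⇒coreDD (coreDD⇒coreBeta 1≤s)
  (λ (tf , pos , _) → betaSet-fromBetaSet (TwinFree⇒Decreasing tf) pos) (λ _ → fromBetaSet-betaSet _)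

-- Twin-free subsets of {1, …, n}

InRange : ℕ → List ℕ → Set
InRange n = All (λ x → 0 < x × x ≤ n)

-- Each subset is listed in decreasing order.
subsets : ℕ → List (List ℕ)
subsets zero = [ [] ]
subsets (suc n) = subsets n ++ map (suc n ∷_) (subsets n)

inRange-suc : ∀ {n β} → InRange n β → InRange (suc n) β
inRange-suc = All.map (λ (0<x , x≤n) → 0<x , m≤n⇒m≤1+n x≤n)

inRange-below : ∀ {n x β} → x ≤ suc n → Decreasing (x ∷ β) → InRange (suc n) β → InRange n β
inRange-below x≤1+n dec range = All.zipWith (λ ((0<y , _) , y<x) → 0<y , ≤-pred (≤-trans y<x x≤1+n))
  (range , Decreasing⇒All<head dec)

∈-subsets⁻ : ∀ {n β} → β ∈ subsets n → InRange n β
∈-subsets⁻ {zero} (here refl) = []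
∈-subsets⁻ {suc n} β∈ with ∈-++⁻ (subsets n) β∈
... | inj₁ β∈′ = inRange-suc (∈-subsets⁻ β∈′)
... | inj₂ β∈′ with ∈-map⁻ (suc n ∷_) β∈′
...   | γ , γ∈ , refl = (s≤s z≤n , ≤-refl) ∷ inRange-suc (∈-subsets⁻ γ∈)

∈-subsets⁺ : ∀ {n β} → Decreasing β → InRange n β → β ∈ subsets n
∈-subsets⁺ {zero} {[]} _ _ = here refl
∈-subsets⁺ {zero} {x ∷ β} _ ((0<x , x≤0) ∷ _) = ⊥-elim (<⇒≱ 0<x x≤0)
∈-subsets⁺ {suc n} {[]} _ _ = ∈-++⁺ˡ (∈-subsets⁺ {n} [] [])
∈-subsets⁺ {suc n} {x ∷ β} dec ((0<x , x≤1+n) ∷ range) with x ≟ suc n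
... | yes refl =
  ∈-++⁺ʳ (subsets n) (∈-map⁺ (suc n ∷_) (∈-subsets⁺ (Linked.tail dec) (inRange-below ≤-refl dec range)))
... | no x≢1+n =
  ∈-++⁺ˡ (∈-subsets⁺ dec ((0<x , ≤-pred (≤∧≢⇒< x≤1+n x≢1+n)) ∷ inRange-below x≤1+n dec range))

subsets-unique : ∀ n → Unique (subsets n)
subsets-unique zero = [] ∷ []
subsets-unique (suc n) = Unique.++⁺ (subsets-unique n) (Unique.map⁺ ∷-injectiveʳ (subsets-unique n)) disjoint
  where
  disjoint : ∀ {β} → ¬ (β ∈ subsets n × β ∈ map (suc n ∷_) (subsets n))
  disjoint (β∈ , β∈′) with ∈-map⁻ (suc n ∷_) β∈′
  ... | _ , _ , refl with ∈-subsets⁻ β∈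
  ...   | (_ , 1+n≤n) ∷ _ = <-irrefl refl 1+n≤n

twinFreeSubsets : ℕ → ℕ → List (List ℕ)
twinFreeSubsets d n = filter (Linked.linked? (λ a b → b + d <? a)) (subsets n)

∈-twinFreeSubsets⁻ : ∀ {d n β} → β ∈ twinFreeSubsets d n → TwinFree d β × InRange n β
∈-twinFreeSubsets⁻ β∈ = let β∈′ , tf = ∈-filter⁻ (Linked.linked? _) β∈ in tf , ∈-subsets⁻ β∈′

∈-twinFreeSubsets⁺ : ∀ {d n β} → TwinFree d β → InRange n β → β ∈ twinFreeSubsets d n
∈-twinFreeSubsets⁺ tf range = ∈-filter⁺ (Linked.linked? _) (∈-subsets⁺ (TwinFree⇒Decreasing tf) range) tf

twinFreeSubsets-unique : ∀ d n → Unique (twinFreeSubsets d n)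
twinFreeSubsets-unique d n = Unique.filter⁺ (Linked.linked? _) (subsets-unique n)

-- The (s, s + r)-closed twin-free β-sets

-- The admissible β-sets with an element ≥ s are exactly these, with 1 ≤ c < r.
bracket : ℕ → ℕ → ℕ → List ℕ → List ℕ
bracket d s c δ = c + s ∷ map (_+ (c + d)) δ ++ [ c ]

brackets : ℕ → ℕ → ℕ → ℕ → List (List ℕ)
brackets d s n m = cartesianProductWith (bracket d s) (applyUpTo suc m) (twinFreeSubsets d n)

coreBeta-twinFreeSubset : ∀ {d r s β} → 1 ≤ s → β ∈ twinFreeSubsets d (s ∸ 1) → CoreBeta d r s β
coreBeta-twinFreeSubset {d} {r} {suc s} {β} _ β∈ =
  tf , All.map proj₁ range , closedUnder-below β<s , closedUnder-below (All.map (λ b<s → <-≤-trans b<s (m≤m+n _ r)) β<s)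
  where
  tf : TwinFree d β
  tf = proj₁ (∈-twinFreeSubsets⁻ {n = s} β∈)
  range : InRange s β
  range = proj₂ (∈-twinFreeSubsets⁻ {n = s} β∈)
  β<s : All (_< suc s) β
  β<s = All.map (s≤s ∘ proj₂) range

bracket-twinFree : ∀ {d s c δ} → d < s → TwinFree d δ → All (λ e → 0 < e × e + 2 * d < s) δ →
                   TwinFree d (bracket d s c δ)
bracket-twinFree {d} {s} {c} {δ} d<s tf fits = Linked.AllPairs⇒Linked
  ( All.++⁺ (All.map⁺ (All.map top-apart fits)) (+-monoʳ-< c d<s ∷ [])
  ∷ AllPairs.++⁺ middle-pairs ([] ∷ []) (All.map⁺ (All.map (λ (0<e , _) → m<n+m k 0<e ∷ []) fits)))
  where
  k : ℕ
  k = c + d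
  regroup : ∀ e c d → e + (c + d) + d ≡ c + (e + 2 * d)
  regroup = solve-∀
  top-apart : ∀ {e} → 0 < e × e + 2 * d < s → Apart d (c + s) (e + k)
  top-apart {e} (_ , e+2d<s) = subst (_< c + s) (sym (regroup e c d)) (+-monoʳ-< c e+2d<s)
  middle-pairs : AllPairs (Apart d) (map (_+ k) δ)
  middle-pairs = AllPairs.map⁺
    (AllPairs.map (λ {a} {b} → Apart-+ {d} {a} {b} k) (Linked.Linked⇒AllPairs Apart-trans tf))

coreBeta-bracket : ∀ {d r s c δ} → 1 ≤ c → c < r → r ≤ d → d < s →
                   δ ∈ twinFreeSubsets d (s ∸ suc (2 * d)) → CoreBeta d r s (bracket d s c δ)
coreBeta-bracket {d} {r} {s} {c} {δ} 1≤c c<r r≤d d<s δ∈ =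
  bracket-twinFree d<s (proj₁ δ-facts) fits , positive , closed-s , closed-s+r
  where
  k : ℕ
  k = c + d
  middle : List ℕ
  middle = map (_+ k) δ
  δ-facts : TwinFree d δ × InRange (s ∸ suc (2 * d)) δ
  δ-facts = ∈-twinFreeSubsets⁻ {n = s ∸ suc (2 * d)} δ∈
  fits : All (λ e → 0 < e × e + 2 * d < s) δ
  fits = All.map (λ {e} (0<e , e≤) → 0<e , subst (_≤ s) (+-suc e (2 * d)) (≤∸⇒+≤ 0<e e≤)) (proj₂ δ-facts)
  c<s : c < s
  c<s = <-≤-trans (<-≤-trans c<r r≤d) (<⇒≤ d<s)
  middle<s : ∀ {e} → 0 < e × e + 2 * d < s → e + k < s
  middle<s {e} (_ , e+2d<s) = begin-strict
    e + (c + d) ≤⟨ +-monoʳ-≤ e (+-monoˡ-≤ d (<⇒≤ (<-≤-trans c<r r≤d))) ⟩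
    e + (d + d) ≡⟨ cong (λ z → e + (d + z)) (sym (+-identityʳ d)) ⟩
    e + 2 * d   <⟨ e+2d<s ⟩
    s           ∎
    where open ≤-Reasoning
  positive : Positive (bracket d s c δ)
  positive = ≤-trans 1≤c (m≤m+n c s)
           ∷ All.++⁺ (All.map⁺ (All.map (λ (0<e , _) → <-≤-trans 0<e (m≤m+n _ k)) fits)) (1≤c ∷ [])
  below-s : All (_< s) (middle ++ [ c ])
  below-s = All.++⁺ (All.map⁺ (All.map middle<s fits)) (c<s ∷ [])
  closed-s : ClosedUnder s (bracket d s c δ)
  closed-s = (λ _ → subst (_∈ middle ++ [ c ]) (sym (m+n∸n≡m c s)) (∈-++⁺ʳ middle (here refl)))
           , closedUnder-below below-s
  closed-s+r : ClosedUnder (s + r) (bracket d s c δ)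
  closed-s+r = (λ s+r≤c+s → ⊥-elim (<⇒≱ c<r (+-cancelˡ-≤ s r c (subst (s + r ≤_) (+-comm c s) s+r≤c+s))))
             , closedUnder-below (All.map (λ x<s → <-≤-trans x<s (m≤m+n s r)) below-s)

split-at-minimum : ∀ {d c bs} → Decreasing bs → c ∈ bs → All (λ y → y ≡ c ⊎ c + d < y) bs →
                   ∃[ γ ] bs ≡ γ ++ [ c ] × All (c + d <_) γ
split-at-minimum {bs = y ∷ []} _ _ (inj₁ refl ∷ []) = [] , refl , []
split-at-minimum {d} {c} {bs = y ∷ z ∷ zs} (z<c ∷ _) _ (inj₁ refl ∷ z-case ∷ _) with z-case
... | inj₁ refl = ⊥-elim (<-irrefl refl z<c)
... | inj₂ c+d<z = ⊥-elim (<-asym z<c (≤-<-trans (m≤m+n c d) c+d<z))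
split-at-minimum {d} {c} (_) (here refl) (inj₂ c+d<c ∷ _) = ⊥-elim (m+n≮m c d c+d<c)
split-at-minimum {bs = y ∷ ys} dec (there c∈) (inj₂ c+d<y ∷ rest) =
  let γ , ys≡ , above = split-at-minimum (Linked.tail dec) c∈ rest in y ∷ γ , cong (y ∷_) ys≡ , c+d<y ∷ above

bracket-shape : ∀ {d s c h bs} → TwinFree d bs → c ∈ bs → c ≤ d → c + s ≡ h → All (Apart d h) bs →
                ∃[ δ ] δ ∈ twinFreeSubsets d (s ∸ suc (2 * d)) × h ∷ bs ≡ bracket d s c δ
bracket-shape {d} {s} {c} {h} {bs} tf c∈ c≤d c+s≡h bs<h = map (_∸ k) γ , δ∈ , shape
  where
  k : ℕ
  k = c + d
  classify : ∀ {y} → y ∈ bs → y ≡ c ⊎ k < y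
  classify {y} y∈ with twinFree-trichotomy tf y∈ c∈
  ... | inj₁ y≡c = inj₁ y≡c
  ... | inj₂ (inj₁ k<y) = inj₂ k<y
  ... | inj₂ (inj₂ y+d<c) = ⊥-elim (<⇒≱ y+d<c (≤-trans c≤d (m≤n+m d y)))
  split : ∃[ γ ] bs ≡ γ ++ [ c ] × All (k <_) γ
  split = split-at-minimum (TwinFree⇒Decreasing tf) c∈ (All.tabulate classify)
  γ : List ℕ
  γ = proj₁ split
  bs≡ : bs ≡ γ ++ [ c ]
  bs≡ = proj₁ (proj₂ split)
  γ>k : All (k <_) γ
  γ>k = proj₂ (proj₂ split)
  regroup : ∀ w c d → w + suc (2 * d) + c ≡ suc (w + (c + d) + d)
  regroup = solve-∀
  fits : ∀ {y} → k < y × Apart d h y → y ∸ k ≤ s ∸ suc (2 * d)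
  fits {y} (k<y , y+d<h) = m+n≤o⇒m≤o∸n (y ∸ k) (+-cancelʳ-≤ c _ s (begin
    y ∸ k + suc (2 * d) + c ≡⟨ regroup (y ∸ k) c d ⟩
    suc (y ∸ k + k + d)     ≡⟨ cong (λ z → suc (z + d)) (m∸n+n≡m (<⇒≤ k<y)) ⟩
    suc (y + d)             ≤⟨ y+d<h ⟩
    h                       ≡⟨ trans (sym c+s≡h) (+-comm c s) ⟩
    s + c                   ∎))
    where open ≤-Reasoning
  γ<h : All (Apart d h) γ
  γ<h = All.++⁻ˡ γ (subst (All (Apart d h)) bs≡ bs<h)
  δ∈ : map (_∸ k) γ ∈ twinFreeSubsets d (s ∸ suc (2 * d))
  δ∈ = ∈-twinFreeSubsets⁺
    (twinFree-∸ k (All.map <⇒≤ γ>k) (Linked-++⁻ˡ γ (subst (TwinFree d) bs≡ tf)))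
    (All.map⁺ (All.zipWith (λ (k<y , y+d<h) → m<n⇒0<n∸m k<y , fits (k<y , y+d<h)) (γ>k , γ<h)))
  shape : h ∷ bs ≡ bracket d s c (map (_∸ k) γ)
  shape = cong₂ _∷_ (sym c+s≡h) (trans bs≡ (cong (_++ [ c ])
    (sym (trans (sym (map-∘ γ)) (map-id-local (All.map (λ k<y → m∸n+n≡m (<⇒≤ k<y)) γ>k))))))

∈-brackets⁺ : ∀ {d s n m c δ} → 1 ≤ c → c ≤ m → δ ∈ twinFreeSubsets d n → bracket d s c δ ∈ brackets d s n m
∈-brackets⁺ {d} {s} {c = suc i} _ i<m δ∈ = ∈-cartesianProductWith⁺ (bracket d s) (∈-applyUpTo⁺ suc i<m) δ∈

∈-brackets⁻ : ∀ {d s n m β} → β ∈ brackets d s n m →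
              ∃[ c ] ∃[ δ ] 1 ≤ c × c ≤ m × δ ∈ twinFreeSubsets d n × β ≡ bracket d s c δ
∈-brackets⁻ {d} {s} {n} {m} β∈
  with ∈-cartesianProductWith⁻ (bracket d s) (applyUpTo suc m) (twinFreeSubsets d n) β∈
... | c , δ , c∈ , δ∈ , refl with ∈-applyUpTo⁻ suc c∈
...   | i , i<m , refl = suc i , δ , s≤s z≤n , i<m , δ∈ , refl

-- c = h − s lies in β; if c ≥ r, then h − s − r ∈ β would lie within distance r ≤ d of c.
coreBeta-bracketed : ∀ {d r s h bs} → 1 ≤ r → r ≤ d → s ≤ h → CoreBeta d r s (h ∷ bs) →
                     d < s × h ∷ bs ∈ brackets d s (s ∸ suc (2 * d)) (r ∸ 1)
coreBeta-bracketed {d} {r} {s} {h} {bs} 1≤r r≤d s≤h (tf , _ ∷ pos , (s-closed , _) , (s+r-closed , _)) =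
  d<s , subst (_∈ brackets d s (s ∸ suc (2 * d)) (r ∸ 1)) (sym h∷bs≡)
              (∈-brackets⁺ {n = s ∸ suc (2 * d)} 1≤c (Equivalence.from (≤∸1⇔< r 1≤c) c<r) δ∈)
  where
  c : ℕ
  c = h ∸ s
  c∈ : c ∈ bs
  c∈ = s-closed s≤h
  c+s≡h : c + s ≡ h
  c+s≡h = m∸n+n≡m s≤h
  bs<h : All (Apart d h) bs
  bs<h = Linked⇒All-head Apart-trans tf
  1≤c : 1 ≤ c
  1≤c = All.lookup pos c∈
  d<s : d < s
  d<s = +-cancelˡ-< c d s (subst (c + d <_) (sym c+s≡h) (All.lookup bs<h c∈))
  c<r : c < r
  c<r with h <? s + r
  ... | yes h<s+r = +-cancelʳ-< s c r (subst₂ _<_ (sym c+s≡h) (+-comm s r) h<s+r)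
  ... | no h≮s+r = ⊥-elim (twinFree-no-close-pair (Linked.tail tf) c∈ (s+r-closed s+r≤h) 1≤r r≤d c≡c′+r)
    where
    s+r≤h : s + r ≤ h
    s+r≤h = ≮⇒≥ h≮s+r
    r≤c : r ≤ c
    r≤c = m+n≤o⇒m≤o∸n r (subst (_≤ h) (+-comm s r) s+r≤h)
    c≡c′+r : c ≡ h ∸ (s + r) + r
    c≡c′+r = trans (sym (m∸n+n≡m r≤c)) (cong (_+ r) (∸-+-assoc h s r))
  shape : ∃[ δ ] δ ∈ twinFreeSubsets d (s ∸ suc (2 * d)) × h ∷ bs ≡ bracket d s c δ
  shape = bracket-shape (Linked.tail tf) c∈ (<⇒≤ (<-≤-trans c<r r≤d)) c+s≡h bs<h
  δ∈ : proj₁ shape ∈ twinFreeSubsets d (s ∸ suc (2 * d))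
  δ∈ = proj₁ (proj₂ shape)
  h∷bs≡ : h ∷ bs ≡ bracket d s c (proj₁ shape)
  h∷bs≡ = proj₂ (proj₂ shape)

coreBeta-classification : ∀ {d r s β} → 1 ≤ r → r ≤ d → 1 ≤ s → CoreBeta d r s β →
  β ∈ twinFreeSubsets d (s ∸ 1) ⊎ (d < s × β ∈ brackets d s (s ∸ suc (2 * d)) (r ∸ 1))
coreBeta-classification {s = s} {[]} _ _ _ _ = inj₁ (∈-twinFreeSubsets⁺ {n = s ∸ 1} [] [])
coreBeta-classification {s = s} {h ∷ bs} 1≤r r≤d 1≤s cb@(tf , pos , _) with h <? s
... | no h≮s = inj₂ (coreBeta-bracketed 1≤r r≤d (≮⇒≥ h≮s) cb)
... | yes h<s = inj₁ (∈-twinFreeSubsets⁺ {n = s ∸ 1} tf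
                      (All.zipWith (λ (0<b , b<s) → 0<b , Equivalence.from (≤∸1⇔< s 0<b) b<s) (pos , below-s)))
  where
  below-s : All (_< s) (h ∷ bs)
  below-s = h<s ∷ All.map (λ b<h → <-trans b<h h<s) (Decreasing⇒All<head (TwinFree⇒Decreasing tf))

-- Counting

bracket-injective : ∀ {d s c c′ δ δ′} → bracket d s c δ ≡ bracket d s c′ δ′ → c ≡ c′ × δ ≡ δ′
bracket-injective {d} {s} {c} {c′} {δ} {δ′} eq with +-cancelʳ-≡ s c c′ (∷-injectiveˡ eq)
... | refl = refl , map-injective (λ {a} {b} → +-cancelʳ-≡ (c + d) a b)
                      (++-cancelʳ [ c ] (map (_+ (c + d)) δ) (map (_+ (c + d)) δ′) (∷-injectiveʳ eq))

brackets-unique : ∀ d s n m → Unique (brackets d s n m)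
brackets-unique d s n m = Unique.cartesianProductWith⁺ (bracket d s) bracket-injective
  (Unique.applyUpTo⁺₁ suc m (λ i<j _ → <⇒≢ (s≤s i<j))) (twinFreeSubsets-unique d n)

length-brackets : ∀ d s n m → length (brackets d s n m) ≡ m * length (twinFreeSubsets d n)
length-brackets d s n m = trans (length-cartesianProductWith (bracket d s) (applyUpTo suc m) (twinFreeSubsets d n))
                                (cong (_* length (twinFreeSubsets d n)) (length-applyUpTo suc m))

twinFreeSubsets-brackets-unique : ∀ d s n m → 1 ≤ s → Unique (twinFreeSubsets d (s ∸ 1) ++ brackets d s n m)
twinFreeSubsets-brackets-unique d s n m 1≤s =
  Unique.++⁺ (twinFreeSubsets-unique d (s ∸ 1)) (brackets-unique d s n m) disjoint
  where
  disjoint : ∀ {β} → ¬ (β ∈ twinFreeSubsets d (s ∸ 1) × β ∈ brackets d s n m)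
  disjoint (β∈ , β∈′) with ∈-brackets⁻ {d} {s} {n} {m} β∈′
  ... | c , δ , _ , _ , _ , refl with ∈-twinFreeSubsets⁻ {n = s ∸ 1} β∈
  ...   | _ , (_ , c+s≤s∸1) ∷ _ = <⇒≱ (∸-monoʳ-< {s} {1} {0} (s≤s z≤n) 1≤s) (≤-trans (m≤n+m s c) c+s≤s∸1)

coreBeta⇔twinFreeSubset : ∀ {d r s} → 1 ≤ r → r ≤ d → 1 ≤ s → s ≤ d ⊎ r ≡ 1 →
                          ∀ β → CoreBeta d r s β ⇔ β ∈ twinFreeSubsets d (s ∸ 1)
coreBeta⇔twinFreeSubset {d} {r} {s} 1≤r r≤d 1≤s small β = mk⇔ to (coreBeta-twinFreeSubset 1≤s)
  where
  to : CoreBeta d r s β → β ∈ twinFreeSubsets d (s ∸ 1)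
  to cb with coreBeta-classification 1≤r r≤d 1≤s cb
  ... | inj₁ β∈ = β∈
  ... | inj₂ (d<s , β∈) = ⊥-elim (no-bracket small d<s β∈)
    where
    no-bracket : s ≤ d ⊎ r ≡ 1 → d < s → ¬ β ∈ brackets d s (s ∸ suc (2 * d)) (r ∸ 1)
    no-bracket (inj₁ s≤d) d<s _ = <⇒≱ d<s s≤d
    no-bracket (inj₂ refl) _ β∈ with ∈-brackets⁻ {d} {s} {s ∸ suc (2 * d)} {0} β∈
    ... | _ , _ , 1≤c , c≤0 , _ = <⇒≱ 1≤c c≤0

coreBeta⇔twinFreeSubset-or-bracket : ∀ {d r s} → 1 ≤ r → r ≤ d → d < s → ∀ β →
  CoreBeta d r s β ⇔ β ∈ twinFreeSubsets d (s ∸ 1) ++ brackets d s (s ∸ suc (2 * d)) (r ∸ 1)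
coreBeta⇔twinFreeSubset-or-bracket {d} {r} {s} 1≤r r≤d d<s β = mk⇔ to from
  where
  1≤s : 1 ≤ s
  1≤s = ≤-trans (s≤s z≤n) d<s
  to : CoreBeta d r s β → β ∈ twinFreeSubsets d (s ∸ 1) ++ brackets d s (s ∸ suc (2 * d)) (r ∸ 1)
  to cb with coreBeta-classification 1≤r r≤d 1≤s cb
  ... | inj₁ β∈ = ∈-++⁺ˡ β∈
  ... | inj₂ (_ , β∈) = ∈-++⁺ʳ (twinFreeSubsets d (s ∸ 1)) β∈
  from : β ∈ twinFreeSubsets d (s ∸ 1) ++ brackets d s (s ∸ suc (2 * d)) (r ∸ 1) → CoreBeta d r s β
  from β∈ with ∈-++⁻ (twinFreeSubsets d (s ∸ 1)) β∈
  ... | inj₁ β∈′ = coreBeta-twinFreeSubset 1≤s β∈′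
  ... | inj₂ β∈′ with ∈-brackets⁻ {d} {s} {s ∸ suc (2 * d)} {r ∸ 1} β∈′
  ...   | c , δ , 1≤c , c≤r∸1 , δ∈ , refl =
    coreBeta-bracket 1≤c (Equivalence.to (≤∸1⇔< r 1≤c) c≤r∸1) r≤d d<s δ∈

N-of-coreBetas : ∀ {d r s xs} → 1 ≤ s → Unique xs → (∀ β → CoreBeta d r s β ⇔ β ∈ xs) → N d r (+ s) (length xs)
N-of-coreBetas {s = suc s} 1≤s unique iff = hasCount-coreDD 1≤s (_ , refl , unique , iff)

N-small : ∀ {d r s} → 1 ≤ r → r ≤ d → 1 ≤ s → s ≤ d ⊎ r ≡ 1 →
          N d r (+ s) (length (twinFreeSubsets d (s ∸ 1)))
N-small {d} {s = s} 1≤r r≤d 1≤s small =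
  N-of-coreBetas 1≤s (twinFreeSubsets-unique d (s ∸ 1)) (coreBeta⇔twinFreeSubset 1≤r r≤d 1≤s small)

N-large : ∀ {d r s} → 1 ≤ r → r ≤ d → d < s →
          N d r (+ s) (length (twinFreeSubsets d (s ∸ 1)) + (r ∸ 1) * length (twinFreeSubsets d (s ∸ suc (2 * d))))
N-large {d} {r} {s} 1≤r r≤d d<s =
  subst (N d r (+ s)) (trans (length-++ (twinFreeSubsets d (s ∸ 1))) (cong (_+_ _) (length-brackets d s n (r ∸ 1))))
        (N-of-coreBetas 1≤s (twinFreeSubsets-brackets-unique d s n (r ∸ 1) 1≤s)
                        (coreBeta⇔twinFreeSubset-or-bracket 1≤r r≤d d<s))
  where
  n : ℕ
  n = s ∸ suc (2 * d)
  1≤s : 1 ≤ s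
  1≤s = ≤-trans (s≤s z≤n) d<s

hasCount-betaSet-nonpositive : ∀ {d z} → z ℤ.≤ + 0 → HasCount (BetaSet d 1 z) 1
hasCount-betaSet-nonpositive {d} {z} z≤0 = [ [] ] , refl , [] ∷ [] , λ β → mk⇔ (to β) from
  where
  z+1-1≡z : (z ℤ.+ + 1) ℤ.- + 1 ≡ z
  z+1-1≡z = trans (ℤ.+-assoc z (+ 1) (ℤ.- + 1))
                  (trans (cong (ℤ._+_ z) (ℤ.+-inverseʳ (+ 1))) (ℤ.+-identityʳ z))
  to : ∀ β → BetaSet d 1 z β → β ∈ [ [] ]
  to [] _ = here refl
  to (x ∷ _) (_ , (1≤x , x≤z+1-1) ∷ _ , _)
    with ℤ.≤-trans 1≤x (ℤ.≤-trans (subst (x ℤ.≤_) z+1-1≡z x≤z+1-1) z≤0)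
  ... | ℤ.+≤+ ()
  from : ∀ {β} → β ∈ [ [] ] → BetaSet d 1 z β
  from (here refl) = [] , [] , [] , [] , λ _ _ ()

N₁-nonpositive : ∀ {d z} → z ℤ.≤ + 0 → N d 1 z 1
N₁-nonpositive {z = + zero} = hasCount-betaSet-nonpositive
N₁-nonpositive {z = -[1+ k ]} = hasCount-betaSet-nonpositive
N₁-nonpositive {z = + suc k} (ℤ.+≤+ ())

N₁-shifted : ∀ {d} s → 1 ≤ d → N d 1 (+ s - + (2 * d)) (length (twinFreeSubsets d (s ∸ suc (2 * d))))
N₁-shifted {d} s 1≤d with suc (2 * d) ≤? s
... | yes 2d<s = subst₂ (N d 1) (sym s-2d≡) (cong (length ∘ twinFreeSubsets d) s∸2d∸1≡)
                        (N-small ≤-refl 1≤d (m<n⇒0<n∸m 2d<s) (inj₂ refl))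
  where
  s-2d≡ : + s - + (2 * d) ≡ + (s ∸ 2 * d)
  s-2d≡ = trans (ℤ.[+m]-[+n]≡m⊖n s (2 * d)) (ℤ.⊖-≥ (<⇒≤ 2d<s))
  s∸2d∸1≡ : s ∸ 2 * d ∸ 1 ≡ s ∸ suc (2 * d)
  s∸2d∸1≡ = trans (∸-+-assoc s (2 * d) 1) (cong (s ∸_) (+-comm (2 * d) 1))
... | no 2d≮s = subst (N d 1 (+ s - + (2 * d))) (cong (length ∘ twinFreeSubsets d) (sym s∸2d+1≡0))
                      (N₁-nonpositive s-2d≤0)
  where
  s≤2d : s ≤ 2 * d
  s≤2d = ≤-pred (≰⇒> 2d≮s)
  s∸2d+1≡0 : s ∸ suc (2 * d) ≡ 0
  s∸2d+1≡0 = m≤n⇒m∸n≡0 (m≤n⇒m≤1+n s≤2d)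
  s-2d≤0 : + s - + (2 * d) ℤ.≤ + 0
  s-2d≤0 = subst (ℤ._≤ + 0) (sym (trans (ℤ.[+m]-[+n]≡m⊖n s (2 * d)) (ℤ.⊖-≤ s≤2d))) ℤ.neg-≤-pos

theorem2p9 : (d r : ℕ) → 1 ≤ r → r ≤ d → (s : ℕ) → 1 ≤ s →
    ((s ≤ d → ∃[ a ] ∃[ b ] (N d r (+ s) a × N d 1 (+ s) b × a ≡ b))
    × (d + 1 ≤ s → ∃[ a ] ∃[ b ] ∃[ c ]
        (N d r (+ s) a × N d 1 (+ s) b × N d 1 (+ s - + (2 * d)) c
          × a ≡ b + (r ∸ 1) * c)))
theorem2p9 d r 1≤r r≤d s 1≤s =
    (λ s≤d → _ , _ , N-small 1≤r r≤d 1≤s (inj₁ s≤d) , N₁ , refl)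
  , (λ d+1≤s → _ , _ , _ , N-large 1≤r r≤d (subst (_≤ s) (+-comm d 1) d+1≤s) , N₁ , N₁-shifted s 1≤d , refl)
  where
  1≤d : 1 ≤ d
  1≤d = ≤-trans 1≤r r≤d
  N₁ : N d 1 (+ s) (length (twinFreeSubsets d (s ∸ 1)))
  N₁ = N-small ≤-refl 1≤d 1≤s (inj₂ refl)
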